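{- For every integer $m\geq 4$, the matching $mP_2$ (the disjoint union of $m$ copies of the complete graph $K_2$) is an integral sum graph and satisfies $r(mP_2)\leq 3m-4$.
   Context: A graph $G$ is an integral sum graph ($\mathbb{Z}$-graph) if there is an injective map $\lambda:V(G)\to\mathbb{Z}$ (a labelling) such that two distinct vertices $u,v$ are adjacent if and only if $\lambda(u)+\lambda(v)\in\lambda(V(G))$. The radius of a labelling is $\max_{v}|\lambda(v)|$, and the radius $r(G)$ of a $\mathbb{Z}$-graph $G$ is the minimum of the radii of all its labellings. -}

module Defs where

open import Level using (Level; suc; _⊔_)
open import Data.Nat using (ℕ; _≤_)
open import Data.Fin using (Fin)
open import Data.Integer using (ℤ; _+_; ∣_∣)
open import Data.Product using (Σ; ∃; _×_; _,_)
open import Relation.Binary.PropositionalEquality using (_≡_; _≢_)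
open import Relation.Nullary using (¬_)
open import Function.Definitions using (Injective)
open import Function.Bundles using (_⇔_)

record Graph (V : Set) : Set₁ where
  field
    Adj     : V → V → Set
    symAdj  : ∀ {u v} → Adj u v → Adj v u
    irrefl  : ∀ {v} → ¬ Adj v v

open Graph public

record IsSumLabelling {V : Set} (G : Graph V) (lab : V → ℤ) : Set where
  field
    injective : Injective _≡_ _≡_ lab
    adjIff    : ∀ u v → u ≢ v → (Adj G u v ⇔ (∃ λ w → lab u + lab v ≡ lab w))

IsZGraph : {V : Set} → Graph V → Set
IsZGraph {V} G = Σ (V → ℤ) (IsSumLabelling G)

RadiusAtMost : {V : Set} → (V → ℤ) → ℕ → Set
RadiusAtMost {V} lab k = ∀ (v : V) → ∣ lab v ∣ ≤ k

-- r(G) ≤ k  (r(G) is the minimum radius over all labellings of G, so this holds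
-- iff some labelling of G has radius at most k).
GraphRadiusAtMost : {V : Set} → Graph V → ℕ → Set
GraphRadiusAtMost {V} G k = Σ (V → ℤ) λ lab → IsSumLabelling G lab × RadiusAtMost lab k

matching : (m : ℕ) → Graph (Fin m × Fin 2)
matching m = record
  { Adj    = λ { (i , a) (j , b) → (i ≡ j) × (a ≢ b) }
  ; symAdj = λ { (Relation.Binary.PropositionalEquality.refl , a≢b) →
                 Relation.Binary.PropositionalEquality.refl , λ e → a≢b (Relation.Binary.PropositionalEquality.sym e) }
  ; irrefl = λ { (_ , a≢a) → a≢a Relation.Binary.PropositionalEquality.refl }
  }

{-# OPTIONS --safe #-}
-- Write n = m - 1 and give the pairs the labels {-2n, n} and {-(n+j), 2n+j} for 0 ≤ j < n.
-- Each pair then sums to -n or to n, both of which are labels. Every other sum misses the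
-- label set {-2n, …, -n} ∪ {n} ∪ {2n, …, 3n-1}: two negative labels sum below -2n, two
-- positive ones above 3n-1, and a mixed sum lies in [-n, 2n-1], where the only labels are
-- ±n, and these are attained only by the pairs themselves.
module Submission where

open import Defs
open import Data.Nat using (ℕ; _≤_; _*_; _∸_)
open import Data.Product using (_×_)

open import Data.Nat using (zero; suc; _+_; _<_; z<s; s≤s)
open import Data.Nat.Properties
open import Data.Nat.Tactic.RingSolver using (solve-∀)
open import Data.Integer as ℤ using (ℤ; +_; -_; ∣_∣)
open import Data.Integer.Properties as ℤ
  using (pos-+; neg-distrib-+; neg-injective; ∣-i∣≡∣i∣)
  renaming (+-injective to +-ℤ-injective)
import Data.Integer.Tactic.RingSolver as ℤ-Solver
open import Data.Fin using (Fin; zero; suc; toℕ)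
open import Data.Fin.Properties using (toℕ-injective; toℕ<n)
open import Data.Product using (∃; _,_)
open import Data.Sum using (_⊎_; inj₁; inj₂)
open import Relation.Nullary using (contradiction)
open import Relation.Binary.PropositionalEquality
open import Function.Bundles using (mk⇔)

-x≡+y⇒x≡0 : ∀ {x y} → - (+ x) ≡ + y → x ≡ 0
-x≡+y⇒x≡0 {zero} _ = refl

-x≡+y⇒y≡0 : ∀ {x y} → - (+ x) ≡ + y → y ≡ 0
-x≡+y⇒y≡0 {zero} e = sym (+-ℤ-injective e)

-[x+y]≡-x+-y : ∀ x y → - (+ (x + y)) ≡ - (+ x) ℤ.+ - (+ y)
-[x+y]≡-x+-y x y = trans (cong -_ (pos-+ x y)) (neg-distrib-+ (+ x) (+ y))

-x+-y≡-z⇒x+y≡z : ∀ x y z → - (+ x) ℤ.+ - (+ y) ≡ - (+ z) → x + y ≡ z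
-x+-y≡-z⇒x+y≡z x y z e = +-ℤ-injective (neg-injective (trans (-[x+y]≡-x+-y x y) e))

-x+-y≡+z⇒x+y≡0 : ∀ x y z → - (+ x) ℤ.+ - (+ y) ≡ + z → x + y ≡ 0
-x+-y≡+z⇒x+y≡0 x y z e = -x≡+y⇒x≡0 (trans (-[x+y]≡-x+-y x y) e)

+x++y≡+z⇒x+y≡z : ∀ x y z → + x ℤ.+ + y ≡ + z → x + y ≡ z
+x++y≡+z⇒x+y≡z x y z e = +-ℤ-injective (trans (pos-+ x y) e)

+x++y≡-z⇒x+y≡0 : ∀ x y z → + x ℤ.+ + y ≡ - (+ z) → x + y ≡ 0
+x++y≡-z⇒x+y≡0 x y z e = -x≡+y⇒y≡0 (sym (trans (pos-+ x y) e))

-x++y≡+z⇒y≡x+z : ∀ x y z → - (+ x) ℤ.+ + y ≡ + z → y ≡ x + z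
-x++y≡+z⇒y≡x+z x y z e = +-ℤ-injective (begin
  + y                        ≡⟨ regroup (+ x) (+ y) ⟩
  + x ℤ.+ (- (+ x) ℤ.+ + y)  ≡⟨ cong (λ t → + x ℤ.+ t) e ⟩
  + x ℤ.+ + z                ≡⟨ pos-+ x z ⟨
  + (x + z)                  ∎)
  where
  open ≡-Reasoning
  regroup : ∀ a b → b ≡ a ℤ.+ (- a ℤ.+ b)
  regroup = ℤ-Solver.solve-∀

-x++y≡-z⇒x≡z+y : ∀ x y z → - (+ x) ℤ.+ + y ≡ - (+ z) → x ≡ z + y
-x++y≡-z⇒x≡z+y x y z e = +-ℤ-injective (neg-injective (begin
  - (+ x)                           ≡⟨ regroup (+ x) (+ y) ⟩
  (- (+ x) ℤ.+ + y) ℤ.+ - (+ y)     ≡⟨ cong (λ t → t ℤ.+ - (+ y)) e ⟩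
  - (+ z) ℤ.+ - (+ y)               ≡⟨ -[x+y]≡-x+-y z y ⟨
  - (+ (z + y))                     ∎))
  where
  open ≡-Reasoning
  regroup : ∀ a b → - a ≡ (- a ℤ.+ b) ℤ.+ - b
  regroup = ℤ-Solver.solve-∀

-x+[x+z]≡z : ∀ x z → - (+ x) ℤ.+ + (x + z) ≡ + z
-x+[x+z]≡z x z = trans (cong (λ t → - (+ x) ℤ.+ t) (pos-+ x z)) (cancel (+ x) (+ z))
  where
  cancel : ∀ a b → - a ℤ.+ (a ℤ.+ b) ≡ b
  cancel = ℤ-Solver.solve-∀

-[z+y]+y≡-z : ∀ z y → - (+ (z + y)) ℤ.+ + y ≡ - (+ z)
-[z+y]+y≡-z z y = trans (cong (ℤ._+ + y) (-[x+y]≡-x+-y z y)) (cancel (+ z) (+ y))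
  where
  cancel : ∀ a b → (- a ℤ.+ - b) ℤ.+ b ≡ - a
  cancel = ℤ-Solver.solve-∀


squeeze : ∀ {x y a b} → a ≤ x → b ≤ y → x + y ≤ a + b → x ≡ a × y ≡ b
squeeze {x} {y} {a} {b} a≤x b≤y x+y≤a+b =
  ≤-antisym (+-cancelʳ-≤ y x a (≤-trans x+y≤a+b (+-monoʳ-≤ a b≤y))) a≤x ,
  ≤-antisym (+-cancelˡ-≤ x y b (≤-trans x+y≤a+b (+-monoˡ-≤ b a≤x))) b≤y

module Labelling (k : ℕ) where

  n : ℕ
  n = suc k

  Vertex : Set
  Vertex = Fin (suc n) × Fin 2

  negMag : Fin (suc n) → ℕ
  negMag zero    = n + n
  negMag (suc j) = n + toℕ j

  posMag : Fin (suc n) → ℕ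
  posMag zero    = n
  posMag (suc j) = n + n + toℕ j

  label : Vertex → ℤ
  label (i , zero)     = - (+ negMag i)
  label (i , suc zero) = + posMag i

  n≤negMag : ∀ i → n ≤ negMag i
  n≤negMag zero    = m≤m+n n n
  n≤negMag (suc j) = m≤m+n n (toℕ j)

  negMag≤2n : ∀ i → negMag i ≤ n + n
  negMag≤2n zero    = ≤-refl
  negMag≤2n (suc j) = +-monoʳ-≤ n (<⇒≤ (toℕ<n j))

  n≤posMag : ∀ i → n ≤ posMag i
  n≤posMag zero    = ≤-refl
  n≤posMag (suc j) = ≤-trans (m≤m+n n n) (m≤m+n (n + n) (toℕ j))

  posMag<3n : ∀ i → posMag i < n + n + n
  posMag<3n zero    = subst (n <_) (sym (+-assoc n n n)) (m<m+n n z<s)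
  posMag<3n (suc j) = +-monoʳ-< (n + n) (toℕ<n j)

  posMag≡n⊎2n≤posMag : ∀ i → posMag i ≡ n ⊎ n + n ≤ posMag i
  posMag≡n⊎2n≤posMag zero    = inj₁ refl
  posMag≡n⊎2n≤posMag (suc j) = inj₂ (m≤m+n (n + n) (toℕ j))

  negMag≢0 : ∀ i → negMag i ≢ 0
  negMag≢0 i e = <-irrefl (sym e) (<-≤-trans z<s (n≤negMag i))

  posMag≢0 : ∀ i → posMag i ≢ 0
  posMag≢0 i e = <-irrefl (sym e) (<-≤-trans z<s (n≤posMag i))

  negMag-injective : ∀ i j → negMag i ≡ negMag j → i ≡ j
  negMag-injective zero    zero    _ = refl
  negMag-injective zero    (suc j) e = contradiction (+-cancelˡ-≡ n n (toℕ j) e) (>⇒≢ (toℕ<n j))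
  negMag-injective (suc i) zero    e = contradiction (+-cancelˡ-≡ n (toℕ i) n e) (<⇒≢ (toℕ<n i))
  negMag-injective (suc i) (suc j) e = cong suc (toℕ-injective (+-cancelˡ-≡ n _ _ e))

  n<2n+t : ∀ t → n < n + n + t
  n<2n+t t = <-≤-trans (m<m+n n z<s) (m≤m+n (n + n) t)

  posMag-injective : ∀ i j → posMag i ≡ posMag j → i ≡ j
  posMag-injective zero    zero    _ = refl
  posMag-injective zero    (suc j) e = contradiction e (<⇒≢ (n<2n+t (toℕ j)))
  posMag-injective (suc i) zero    e = contradiction e (>⇒≢ (n<2n+t (toℕ i)))
  posMag-injective (suc i) (suc j) e = cong suc (toℕ-injective (+-cancelˡ-≡ (n + n) _ _ e))

  label-injective : ∀ {u v} → label u ≡ label v → u ≡ v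
  label-injective {i , zero}     {j , zero}     e =
    cong (_, zero) (negMag-injective i j (+-ℤ-injective (neg-injective e)))
  label-injective {i , zero}     {j , suc zero} e = contradiction (-x≡+y⇒x≡0 e) (negMag≢0 i)
  label-injective {i , suc zero} {j , zero}     e = contradiction (-x≡+y⇒x≡0 (sym e)) (negMag≢0 j)
  label-injective {i , suc zero} {j , suc zero} e =
    cong (_, suc zero) (posMag-injective i j (+-ℤ-injective e))

  pair-sum-is-label : ∀ i → ∃ λ w → label (i , zero) ℤ.+ label (i , suc zero) ≡ label w
  pair-sum-is-label zero    =
    (suc zero , zero) , trans (-[z+y]+y≡-z n n) (cong (λ t → - (+ t)) (sym (+-identityʳ n)))
  pair-sum-is-label (suc j) =
    (zero , suc zero) , trans (cong (λ t → - (+ (n + toℕ j)) ℤ.+ + t) (reorder n (toℕ j)))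
                              (-x+[x+z]≡z (n + toℕ j) n)
    where
    reorder : ∀ a b → a + a + b ≡ a + b + a
    reorder = solve-∀

  negative-sum-is-label⇒≡ : ∀ i j w → label (i , zero) ℤ.+ label (j , zero) ≡ label w → i ≡ j
  negative-sum-is-label⇒≡ i j (l , zero) e
    with squeeze (n≤negMag i) (n≤negMag j)
                 (subst (_≤ n + n) (sym (-x+-y≡-z⇒x+y≡z (negMag i) (negMag j) (negMag l) e)) (negMag≤2n l))
  ... | x≡n , y≡n = negMag-injective i j (trans x≡n (sym y≡n))
  negative-sum-is-label⇒≡ i j (l , suc zero) e =
    contradiction (m+n≡0⇒m≡0 (negMag i) (-x+-y≡+z⇒x+y≡0 (negMag i) (negMag j) (posMag l) e)) (negMag≢0 i)

  posMag≡n-if-sum<3n : ∀ i j → posMag i + posMag j < n + n + n → posMag i ≡ n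
  posMag≡n-if-sum<3n i j sum<3n with posMag≡n⊎2n≤posMag i
  ... | inj₁ x≡n   = x≡n
  ... | inj₂ 2n≤x = contradiction sum<3n (≤⇒≯ (+-mono-≤ 2n≤x (n≤posMag j)))

  positive-sum-is-label⇒≡ : ∀ i j w → label (i , suc zero) ℤ.+ label (j , suc zero) ≡ label w → i ≡ j
  positive-sum-is-label⇒≡ i j (l , suc zero) e =
    posMag-injective i j (trans (posMag≡n-if-sum<3n i j sum<3n)
                                (sym (posMag≡n-if-sum<3n j i (subst (_< n + n + n) (+-comm (posMag i) (posMag j)) sum<3n))))
    where
    sum<3n : posMag i + posMag j < n + n + n
    sum<3n = subst (_< n + n + n) (sym (+x++y≡+z⇒x+y≡z (posMag i) (posMag j) (posMag l) e)) (posMag<3n l)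
  positive-sum-is-label⇒≡ i j (l , zero) e =
    contradiction (m+n≡0⇒m≡0 (posMag i) (+x++y≡-z⇒x+y≡0 (posMag i) (posMag j) (negMag l) e)) (posMag≢0 i)

  posMag≡negMag+n⇒≡ : ∀ i j → posMag j ≡ negMag i + n → i ≡ j
  posMag≡negMag+n⇒≡ i zero    e = contradiction (+-cancelʳ-≡ n (negMag i) 0 (sym e)) (negMag≢0 i)
  posMag≡negMag+n⇒≡ i (suc j) e =
    sym (negMag-injective (suc j) i (+-cancelʳ-≡ n _ _ (trans (reorder n (toℕ j)) e)))
    where
    reorder : ∀ a b → a + b + a ≡ a + a + b
    reorder = solve-∀

  mixed-sum-is-label⇒≡ : ∀ i j w → label (i , zero) ℤ.+ label (j , suc zero) ≡ label w → i ≡ j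
  mixed-sum-is-label⇒≡ i j (l , suc zero) e = positive-result (-x++y≡+z⇒y≡x+z (negMag i) (posMag j) (posMag l) e)
    where
    positive-result : posMag j ≡ negMag i + posMag l → i ≡ j
    positive-result y≡x+z with posMag≡n⊎2n≤posMag l
    ... | inj₁ z≡n  = posMag≡negMag+n⇒≡ i j (trans y≡x+z (cong (λ t → negMag i + t) z≡n))
    ... | inj₂ 2n≤z = contradiction (posMag<3n j) (≤⇒≯ (begin
      n + n + n             ≡⟨ +-comm (n + n) n ⟩
      n + (n + n)           ≤⟨ +-mono-≤ (n≤negMag i) 2n≤z ⟩
      negMag i + posMag l   ≡⟨ y≡x+z ⟨
      posMag j              ∎))
      where open ≤-Reasoning
  mixed-sum-is-label⇒≡ i j (l , zero) e = negative-result (-x++y≡-z⇒x≡z+y (negMag i) (posMag j) (negMag l) e)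
    where
    negative-result : negMag i ≡ negMag l + posMag j → i ≡ j
    negative-result x≡z+y
      with squeeze (n≤negMag l) (n≤posMag j) (subst (_≤ n + n) x≡z+y (negMag≤2n i))
    ... | z≡n , y≡n = trans (negMag-injective i zero (trans x≡z+y (cong₂ _+_ z≡n y≡n)))
                            (sym (posMag-injective j zero y≡n))

  sum-is-label⇒same-pair : ∀ i a j b w → label (i , a) ℤ.+ label (j , b) ≡ label w → i ≡ j
  sum-is-label⇒same-pair i zero       j zero       = negative-sum-is-label⇒≡ i j
  sum-is-label⇒same-pair i (suc zero) j (suc zero) = positive-sum-is-label⇒≡ i j
  sum-is-label⇒same-pair i zero       j (suc zero) = mixed-sum-is-label⇒≡ i j
  sum-is-label⇒same-pair i (suc zero) j zero       w e =
    sym (mixed-sum-is-label⇒≡ j i w (trans (ℤ.+-comm (label (j , zero)) (label (i , suc zero))) e))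

  adjacent⇒sum-is-label : ∀ u v → Adj (matching (suc n)) u v → ∃ λ w → label u ℤ.+ label v ≡ label w
  adjacent⇒sum-is-label (i , zero)     (.i , zero)     (refl , a≢b) = contradiction refl a≢b
  adjacent⇒sum-is-label (i , suc zero) (.i , suc zero) (refl , a≢b) = contradiction refl a≢b
  adjacent⇒sum-is-label (i , zero)     (.i , suc zero) (refl , _)   = pair-sum-is-label i
  adjacent⇒sum-is-label (i , suc zero) (.i , zero)     (refl , _)   with pair-sum-is-label i
  ... | w , e = w , trans (ℤ.+-comm (label (i , suc zero)) (label (i , zero))) e

  sum-is-label⇒adjacent : ∀ u v → u ≢ v → (∃ λ w → label u ℤ.+ label v ≡ label w) → Adj (matching (suc n)) u v
  sum-is-label⇒adjacent (i , a) (j , b) u≢v (w , e) = i≡j , λ a≡b → u≢v (cong₂ _,_ i≡j a≡b)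
    where
    i≡j : i ≡ j
    i≡j = sum-is-label⇒same-pair i a j b w e

  label-isSumLabelling : IsSumLabelling (matching (suc n)) label
  label-isSumLabelling = record
    { injective = label-injective
    ; adjIff    = λ u v u≢v → mk⇔ (adjacent⇒sum-is-label u v) (sum-is-label⇒adjacent u v u≢v)
    }

  ∣label∣<3n : ∀ v → ∣ label v ∣ < n + n + n
  ∣label∣<3n (i , zero)     = subst (_< n + n + n) (sym (∣-i∣≡∣i∣ (+ negMag i)))
                                    (≤-<-trans (negMag≤2n i) (m<m+n (n + n) z<s))
  ∣label∣<3n (i , suc zero) = posMag<3n i

3[2+k]∸4≡3[1+k]∸1 : ∀ k → 3 * suc (suc k) ∸ 4 ≡ k + suc k + suc k
3[2+k]∸4≡3[1+k]∸1 k = trans (cong (_∸ 4) (expand k)) (m+n∸m≡n 4 (k + suc k + suc k))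
  where
  expand : ∀ k → 3 * suc (suc k) ≡ 4 + (k + suc k + suc k)
  expand = solve-∀

-- The labelling works for every m ≥ 2; the hypothesis 4 ≤ m only rules out m = 0, 1.
mainTheorem6 : (m : ℕ) → 4 ≤ m → IsZGraph (matching m) × GraphRadiusAtMost (matching m) (3 * m ∸ 4)
mainTheorem6 (suc zero)    (s≤s ())
mainTheorem6 (suc (suc k)) _ = (label , label-isSumLabelling) , label , label-isSumLabelling , radius
  where
  open Labelling k
  radius : RadiusAtMost label (3 * suc (suc k) ∸ 4)
  radius v = subst (∣ label v ∣ ≤_) (sym (3[2+k]∸4≡3[1+k]∸1 k)) (≤-pred (∣label∣<3n v))
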